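{- For all $n \ge 1$, all $k \ge 2$, and all $i$ with $1 \le i \le k-1$, the map $$\sigma \mapsto n-i+1,\ n-i+2,\ \ldots,\ n,\ \sigma$$ (prepending the increasing run $n-i+1,\dots,n$ to $\sigma$) is a bijection from $S_{n-i}(12\ldots k, 132, 213)$ onto the set of $\pi \in S_n(12\ldots k, 132, 213)$ with $\pi^{ -1}(n) = i$.
   Context: Permutations of $[n]$ are written in one-line notation, and $S_n$ denotes the set of them; $\pi^{ -1}(n)$ is the position of the entry $n$. A permutation $\pi\in S_n$ contains $\sigma\in S_m$ if there are indices $i_1<\dots<i_m$ such that for all $a,b$, $\pi(i_a)<\pi(i_b)$ iff $\sigma(a)<\sigma(b)$; otherwise $\pi$ avoids $\sigma$. For a set $R$ of permutations, $S_n(R)$ is the set of $\pi\in S_n$ avoiding every element of $R$. By convention $S_0(R)$ consists of the empty permutation only and $S_m(R)=\emptyset$ for $m<0$. $12\ldots k$ is the identity permutation of length $k$. -}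

module Defs where

open import Data.Nat using (ℕ; zero; suc; _+_; _∸_; _<_)
open import Data.List using (List; []; _∷_; _++_; map; upTo; length; lookup)
open import Data.List.Relation.Binary.Permutation.Propositional using (_↭_)
open import Data.List.Relation.Binary.Sublist.Propositional using (_⊆_)
open import Data.List.Relation.Binary.Pointwise using (Pointwise)
open import Data.List.Membership.Propositional using (_∈_)
open import Data.List.Relation.Unary.All using (All)
open import Data.Fin using (Fin; toℕ)
open import Data.Product using (_×_; ∃; ∃-syntax)
open import Function.Bundles using (_⇔_)
open import Relation.Binary.PropositionalEquality using (_≡_)
open import Relation.Nullary using (¬_)

-- [n] = 1,2,...,n  (also the identity permutation 12...n in one-line notation)
oneTo : ℕ → List ℕ
oneTo n = map suc (upTo n)

IsPerm : ℕ → List ℕ → Set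
IsPerm n π = π ↭ oneTo n

-- s and t have the same relative order: for every pair of positions a < b,
-- s(a) < s(b) iff t(a) < t(b), and s(b) < s(a) iff t(b) < t(a).
data OrderIso : List ℕ → List ℕ → Set where
  []  : OrderIso [] []
  _∷_ : ∀ {x y xs ys} →
        Pointwise (λ x' y' → ((x < x') ⇔ (y < y')) × ((x' < x) ⇔ (y' < y))) xs ys →
        OrderIso xs ys → OrderIso (x ∷ xs) (y ∷ ys)

Contains : List ℕ → List ℕ → Set
Contains π σ = ∃[ s ] (s ⊆ π × OrderIso s σ)

Avoids : List ℕ → List ℕ → Set
Avoids π σ = ¬ Contains π σ

InS : ℕ → List (List ℕ) → List ℕ → Set
InS n R π = IsPerm n π × All (Avoids π) R

R : ℕ → List (List ℕ)
R k = oneTo k ∷ (1 ∷ 3 ∷ 2 ∷ []) ∷ (2 ∷ 1 ∷ 3 ∷ []) ∷ []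

-- π⁻¹(n) = i  (1-based position of the entry n is i)
PosIs : List ℕ → ℕ → ℕ → Set
PosIs π n i = ∃[ j ] (toℕ {length π} j + 1 ≡ i × lookup π j ≡ n)

run : ℕ → ℕ → List ℕ
run n i = map (λ j → suc j + (n ∸ i)) (upTo i)

prepend : ℕ → ℕ → List ℕ → List ℕ
prepend n i σ = run n i ++ σ

-- domain: S_{n-i}(R), with S_m = ∅ for m < 0 (i.e. empty when i > n)
Dom : ℕ → ℕ → ℕ → List ℕ → Set
Dom n k i σ = ∃[ m ] (m + i ≡ n × InS m (R k) σ)

Cod : ℕ → ℕ → ℕ → List ℕ → Set
Cod n k i π = InS n (R k) π × PosIs π n i

-- The run L = n-i+1 … n is increasing and lies above every entry of σ ∈ S_{n-i}. An occurrence
-- of a pattern in L σ lies inside L, lies inside σ, or starts in L and ends in σ and hence ends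
-- below its start. Each of 12…k, 132, 213 ends above its start, and none fits into L: 12…k is
-- longer than i < k, and 132, 213 are not increasing. Conversely, if π avoids 132 and 213 and
-- π⁻¹(n) = i, avoiding 213 makes the entries before n increase and avoiding 132 puts them above
-- every entry after n, so the first i entries of π are the i largest values in increasing order.
module Submission where

open import Defs
open import Data.Nat using (ℕ; zero; suc; _+_; _∸_; _≤_; _<_; z≤n; s≤s; z<s; s<s)
open import Data.Nat.Properties
open import Data.List using (List; []; _∷_; _++_; _∷ʳ_; [_]; map; upTo; length; lookup; initLast; _∷ʳ′_)
open import Data.List.Properties using (++-assoc; ++-identityʳ; ++-cancelˡ; length-++; length-map; length-upTo; map-++; upTo-∷ʳ; ∷-injective; ∷ʳ-injective)
open import Data.List.Membership.Propositional using (_∈_)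
open import Data.List.Membership.Propositional.Properties using (∈-++⁺ˡ; ∈-++⁺ʳ; ∈-++⁻; ∈-map⁻; ∈-map⁺; ∈-upTo⁻; ∈-upTo⁺)
open import Data.List.Relation.Unary.Any using (here; there)
open import Data.List.Relation.Unary.All as All using (All; []; _∷_)
open import Data.List.Relation.Unary.All.Properties using () renaming (++⁺ to All-++⁺; ++⁻ˡ to All-++⁻ˡ; ++⁻ʳ to All-++⁻ʳ)
open import Data.List.Relation.Unary.AllPairs using (AllPairs; []; _∷_)
import Data.List.Relation.Unary.AllPairs.Properties as AllPairs
open import Data.List.Relation.Unary.Unique.Propositional using (Unique)
import Data.List.Relation.Unary.Unique.Propositional.Properties as Unique
import Data.List.Relation.Binary.Sublist.Propositional as Sublist
open Sublist using (_⊆_; []; _∷_; ⊆-refl; ⊆-trans; minimum; to∈; from∈)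
open import Data.List.Relation.Binary.Sublist.Propositional.Properties using (Any-resp-⊆; All-resp-⊆; ++⁺; ++⁺ʳ; length-mono-≤)
open import Data.List.Relation.Binary.Permutation.Propositional using (_↭_; ↭-sym; ↭⇒↭ₛ; module PermutationReasoning)
open import Data.List.Relation.Binary.Permutation.Propositional.Properties using (∈-resp-↭; ++⁺ˡ; ++-comm; shift; drop-mid)
import Data.List.Relation.Binary.Permutation.Setoid.Properties as Permutationₛ
open import Data.List.Relation.Binary.Pointwise using (Pointwise; []; _∷_)
open import Data.Fin using (Fin; toℕ) renaming (zero to fzero; suc to fsuc)
open import Data.Product using (∃-syntax; ∃₂; _×_; _,_; proj₁; proj₂; swap)
open import Data.Sum using (_⊎_; inj₁; inj₂)
open import Function.Base using (const)
open import Function.Bundles using (_⇔_; mk⇔; Equivalence)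
open import Relation.Binary.PropositionalEquality using (_≡_; _≢_; ≢-sym; refl; sym; trans; cong; subst; subst₂; setoid; module ≡-Reasoning)
open import Relation.Binary.Definitions using (tri<; tri≈; tri>)
open import Relation.Nullary using (¬_; contradiction)

AllPairs-∷ʳ⁻ : ∀ {A : Set} {R : A → A → Set} xs {y} → AllPairs R (xs ∷ʳ y) →
               AllPairs R xs × All (λ x → R x y) xs
AllPairs-∷ʳ⁻ []       _          = [] , []
AllPairs-∷ʳ⁻ (x ∷ xs) (Rx ∷ Rxs) with AllPairs-∷ʳ⁻ xs Rxs
... | Rxs′ , Rxsy = All-++⁻ˡ xs Rx ∷ Rxs′ , All.head (All-++⁻ʳ xs Rx) ∷ Rxsy

AllPairs-fromPairs : ∀ {A : Set} {R : A → A → Set} {xs} →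
                     (∀ {x y} → x ∷ y ∷ [] ⊆ xs → R x y) → AllPairs R xs
AllPairs-fromPairs {xs = []}     _ = []
AllPairs-fromPairs {xs = x ∷ xs} R-pairs =
  All.tabulate (λ y∈xs → R-pairs (refl ∷ from∈ y∈xs)) ∷
  AllPairs-fromPairs (λ xy⊆xs → R-pairs (x Sublist.∷ʳ xy⊆xs))

AllPairs-resp-⊇ : ∀ {A : Set} {R : A → A → Set} {xs ys} → xs ⊆ ys → AllPairs R ys → AllPairs R xs
AllPairs-resp-⊇ []                  []         = []
AllPairs-resp-⊇ (_ Sublist.∷ʳ xs⊆) (_ ∷ Rys)  = AllPairs-resp-⊇ xs⊆ Rys
AllPairs-resp-⊇ (refl ∷ xs⊆)       (Ry ∷ Rys) = All-resp-⊆ xs⊆ Ry ∷ AllPairs-resp-⊇ xs⊆ Rys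

Unique-pair : ∀ {A : Set} {xs} {x y : A} → Unique xs → x ∷ y ∷ [] ⊆ xs → x ≢ y
Unique-pair (_ ∷ u)  (_ Sublist.∷ʳ xy⊆xs) = Unique-pair u xy⊆xs
Unique-pair (x≢ ∷ _) (refl ∷ y⊆xs)        = All.lookup x≢ (to∈ y⊆xs)

⊆-++⁻ : ∀ {A : Set} (xs : List A) {ys s} → s ⊆ xs ++ ys →
        ∃₂ λ s₁ s₂ → s ≡ s₁ ++ s₂ × s₁ ⊆ xs × s₂ ⊆ ys
⊆-++⁻ []       s⊆ys = [] , _ , refl , [] , s⊆ys
⊆-++⁻ (x ∷ xs) (.x Sublist.∷ʳ s⊆) with ⊆-++⁻ xs s⊆
... | s₁ , s₂ , refl , s₁⊆ , s₂⊆ = s₁ , s₂ , refl , x Sublist.∷ʳ s₁⊆ , s₂⊆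
⊆-++⁻ (x ∷ xs) (refl ∷ s⊆) with ⊆-++⁻ xs s⊆
... | s₁ , s₂ , refl , s₁⊆ , s₂⊆ = x ∷ s₁ , s₂ , refl , refl ∷ s₁⊆ , s₂⊆

Pointwise-∷ʳ⁻ : ∀ {A B : Set} {R : A → B → Set} xs {x ys} → Pointwise R (xs ∷ʳ x) ys →
                ∃₂ λ ys′ y → ys ≡ ys′ ∷ʳ y × R x y
Pointwise-∷ʳ⁻ []       (Rxy ∷ [])  = [] , _ , refl , Rxy
Pointwise-∷ʳ⁻ (_ ∷ xs) (_ ∷ Rxsys) with Pointwise-∷ʳ⁻ xs Rxsys
... | ys′ , y , refl , Rxy = _ ∷ ys′ , y , refl , Rxy

length-∷ʳ : ∀ {A : Set} (xs : List A) x → length (xs ∷ʳ x) ≡ suc (length xs)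
length-∷ʳ xs x = trans (length-++ xs) (+-comm (length xs) 1)

lookup-++-∷ : ∀ {A : Set} (pre : List A) x post →
              ∃[ j ] (toℕ j ≡ length pre × lookup (pre ++ x ∷ post) j ≡ x)
lookup-++-∷ []        x post = fzero , refl , refl
lookup-++-∷ (_ ∷ pre) x post with lookup-++-∷ pre x post
... | j , j≡ , lookup≡ = fsuc j , cong suc j≡ , lookup≡

lookup-split : ∀ {A : Set} (xs : List A) (j : Fin (length xs)) →
               ∃₂ λ pre post → xs ≡ pre ++ lookup xs j ∷ post × length pre ≡ toℕ j
lookup-split (x ∷ xs) fzero    = [] , xs , refl , refl
lookup-split (x ∷ xs) (fsuc j) with lookup-split xs j
... | pre , post , xs≡ , len = x ∷ pre , post , cong (x ∷_) xs≡ , cong suc len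

map-upTo-increasing : ∀ {f : ℕ → ℕ} → (∀ {a b} → a < b → f a < f b) → ∀ n →
                      AllPairs _<_ (map f (upTo n))
map-upTo-increasing f-mono n =
  AllPairs.map⁺ (AllPairs.applyUpTo⁺₁ (λ a → a) n (λ a<b _ → f-mono a<b))

oneTo-increasing : ∀ n → AllPairs _<_ (oneTo n)
oneTo-increasing = map-upTo-increasing s<s

run-increasing : ∀ n i → AllPairs _<_ (run n i)
run-increasing n i = map-upTo-increasing (λ a<b → +-monoˡ-< (n ∸ i) (s<s a<b)) i

oneTo-unique : ∀ n → Unique (oneTo n)
oneTo-unique n = Unique.map⁺ suc-injective (Unique.upTo⁺ n)

∈-oneTo⇒≤ : ∀ {x n} → x ∈ oneTo n → x ≤ n
∈-oneTo⇒≤ x∈ with ∈-map⁻ suc x∈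
... | _ , j∈ , refl = ∈-upTo⁻ j∈

1+n∈oneTo[1+n] : ∀ n → suc n ∈ oneTo (suc n)
1+n∈oneTo[1+n] n = ∈-map⁺ suc (∈-upTo⁺ (n<1+n n))

∈-run⇒> : ∀ {x} m i → x ∈ run (m + i) i → m < x
∈-run⇒> m i x∈ with ∈-map⁻ _ x∈
... | j , _ , refl = s≤s (subst (_≤ j + (m + i ∸ i)) (m+n∸n≡m m i) (m≤n+m _ j))

length-oneTo : ∀ n → length (oneTo n) ≡ n
length-oneTo n = trans (length-map suc (upTo n)) (length-upTo n)

length-run : ∀ n i → length (run n i) ≡ i
length-run n i = trans (length-map _ (upTo i)) (length-upTo i)

oneTo-∷ʳ : ∀ n → oneTo (suc n) ≡ oneTo n ∷ʳ suc n
oneTo-∷ʳ n = trans (cong (map suc) (sym (upTo-∷ʳ n))) (map-++ suc (upTo n) [ n ])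

run-∷ʳ : ∀ n i → i ≤ n → run (suc n) (suc i) ≡ run n i ∷ʳ suc n
run-∷ʳ n i i≤n = begin
  map f (upTo (suc i))      ≡⟨ cong (map f) (sym (upTo-∷ʳ i)) ⟩
  map f (upTo i ∷ʳ i)       ≡⟨ map-++ f (upTo i) [ i ] ⟩
  run n i ∷ʳ suc (i + (n ∸ i)) ≡⟨ cong (λ x → run n i ∷ʳ suc x) (m+[n∸m]≡n i≤n) ⟩
  run n i ∷ʳ suc n          ∎
  where
  open ≡-Reasoning
  f : ℕ → ℕ
  f j = suc j + (n ∸ i)

oneTo-++-run : ∀ m i → oneTo (m + i) ≡ oneTo m ++ run (m + i) i
oneTo-++-run m zero rewrite +-identityʳ m = sym (++-identityʳ (oneTo m))
oneTo-++-run m (suc i) rewrite +-suc m i = begin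
  oneTo (suc (m + i))                         ≡⟨ oneTo-∷ʳ (m + i) ⟩
  oneTo (m + i) ∷ʳ suc (m + i)                ≡⟨ cong (_∷ʳ suc (m + i)) (oneTo-++-run m i) ⟩
  (oneTo m ++ run (m + i) i) ∷ʳ suc (m + i)   ≡⟨ ++-assoc (oneTo m) _ _ ⟩
  oneTo m ++ run (m + i) i ∷ʳ suc (m + i)     ≡⟨ cong (oneTo m ++_) (sym (run-∷ʳ (m + i) i (m≤n+m i m))) ⟩
  oneTo m ++ run (suc (m + i)) (suc i)        ∎
  where open ≡-Reasoning

PosIs-++ : ∀ pre x post → PosIs (pre ++ x ∷ post) x (length pre + 1)
PosIs-++ pre x post with lookup-++-∷ pre x post
... | j , j≡ , lookup≡ = j , cong (_+ 1) j≡ , lookup≡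

PosIs⇒++ : ∀ {π x i} → PosIs π x i → ∃₂ λ pre post → π ≡ pre ++ x ∷ post × length pre + 1 ≡ i
PosIs⇒++ {π} (j , j+1≡i , refl) with lookup-split π j
... | pre , post , π≡ , len = pre , post , π≡ , trans (cong (_+ 1) len) j+1≡i

PosIs-run : ∀ n i σ → 1 ≤ i → i ≤ n → PosIs (run n i ++ σ) n i
PosIs-run (suc n) (suc i) σ _ (s≤s i≤n) =
  subst₂ (λ π j → PosIs π (suc n) j) π≡ len (PosIs-++ (run n i) (suc n) σ)
  where
  π≡ : run n i ++ suc n ∷ σ ≡ run (suc n) (suc i) ++ σ
  π≡ = trans (sym (++-assoc (run n i) [ suc n ] σ)) (cong (_++ σ) (sym (run-∷ʳ n i i≤n)))
  len : length (run n i) + 1 ≡ suc i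
  len = trans (cong (_+ 1) (length-run n i)) (+-comm i 1)

SameOrder : ℕ → ℕ → ℕ → ℕ → Set
SameOrder a x b y = ((a < b) ⇔ (x < y)) × ((b < a) ⇔ (y < x))

sameOrder : ∀ {a b x y} → a < b → x < y → SameOrder a x b y
sameOrder a<b x<y =
  mk⇔ (const x<y) (const a<b) ,
  mk⇔ (λ b<a → contradiction b<a (<-asym a<b)) (λ y<x → contradiction y<x (<-asym x<y))

orderIso₃ : ∀ {a b c x y z} → SameOrder a x b y → SameOrder a x c z → SameOrder b y c z →
            OrderIso (a ∷ b ∷ c ∷ []) (x ∷ y ∷ z ∷ [])
orderIso₃ ab ac bc = (ab ∷ ac ∷ []) ∷ (bc ∷ []) ∷ [] ∷ []

orderIso-213 : ∀ {x y z} → y < x → x < z → OrderIso (x ∷ y ∷ z ∷ []) (2 ∷ 1 ∷ 3 ∷ [])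
orderIso-213 y<x x<z =
  orderIso₃ (swap (sameOrder y<x (s<s z<s)))
            (sameOrder x<z (s<s (s<s z<s)))
            (sameOrder (<-trans y<x x<z) (s<s z<s))

orderIso-132 : ∀ {x y z} → x < z → z < y → OrderIso (x ∷ y ∷ z ∷ []) (1 ∷ 3 ∷ 2 ∷ [])
orderIso-132 x<z z<y =
  orderIso₃ (sameOrder (<-trans x<z z<y) (s<s z<s))
            (sameOrder x<z (s<s z<s))
            (swap (sameOrder z<y (s<s (s<s z<s))))

OrderIso-increasing : ∀ {s p} → OrderIso s p → AllPairs _<_ s → AllPairs _<_ p
OrderIso-increasing []        []        = []
OrderIso-increasing (pw ∷ oi) (x< ∷ s<) = above pw x< ∷ OrderIso-increasing oi s<
  where
  above : ∀ {x y xs ys} → Pointwise (SameOrder x y) xs ys → All (x <_) xs → All (y <_) ys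
  above []         []         = []
  above (xy ∷ pw′) (x<x′ ∷ x<) = Equivalence.to (proj₁ xy) x<x′ ∷ above pw′ x<

EndsBelowStart : List ℕ → Set
EndsBelowStart p = ∃[ y ] ∃[ ys ] ∃[ w ] (p ≡ y ∷ ys ∷ʳ w × w < y)

OrderIso-EndsBelowStart : ∀ {s p} → EndsBelowStart s → OrderIso s p → EndsBelowStart p
OrderIso-EndsBelowStart (y , ys , w , refl , w<y) (pw ∷ _) with Pointwise-∷ʳ⁻ ys pw
... | ps , w′ , refl , yw = _ , ps , w′ , refl , Equivalence.to (proj₂ yw) w<y

EndsBelowStart-∷ʳ : ∀ {y ys w} → EndsBelowStart (y ∷ ys ∷ʳ w) → w < y
EndsBelowStart-∷ʳ {ys = ys} (_ , ys′ , _ , eq , w<y) with ∷-injective eq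
... | refl , eq′ with ∷ʳ-injective ys ys′ eq′
... | refl , refl = w<y

increasing⇒¬EndsBelowStart : ∀ {p} → AllPairs _<_ p → ¬ EndsBelowStart p
increasing⇒¬EndsBelowStart (y< ∷ _) (_ , ys , _ , refl , w<y) =
  <-asym (All.head (All-++⁻ʳ ys y<)) w<y

Avoids-⊆ : ∀ {σ π p} → σ ⊆ π → Avoids π p → Avoids σ p
Avoids-⊆ σ⊆π avoids (s , s⊆σ , oi) = avoids (s , ⊆-trans s⊆σ σ⊆π , oi)

Avoids-increasing : ∀ {L p} → AllPairs _<_ L → ¬ AllPairs _<_ p → Avoids L p
Avoids-increasing L< ¬p< (s , s⊆L , oi) = ¬p< (OrderIso-increasing oi (AllPairs-resp-⊇ s⊆L L<))

Avoids-shorter : ∀ {L p} → length L < length p → Avoids L p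
Avoids-shorter L<p (s , s⊆L , oi) =
  <-irrefl (oi-length oi) (≤-<-trans (length-mono-≤ s⊆L) L<p)
  where
  oi-length : ∀ {s p} → OrderIso s p → length s ≡ length p
  oi-length []       = refl
  oi-length (_ ∷ oi) = cong suc (oi-length oi)

Above : List ℕ → List ℕ → Set
Above xs ys = ∀ {x y} → x ∈ xs → y ∈ ys → y < x

occurrence-split : ∀ {L σ s} → Above L σ → s ⊆ L ++ σ → s ⊆ L ⊎ s ⊆ σ ⊎ EndsBelowStart s
occurrence-split {L} L>σ s⊆ with ⊆-++⁻ L s⊆
... | []     , s₂ , refl , _      , s₂⊆σ = inj₂ (inj₁ s₂⊆σ)
... | x ∷ s₁ , s₂ , refl , x∷s₁⊆L , s₂⊆σ with initLast s₂
...   | []        = inj₁ (subst (_⊆ L) (sym (++-identityʳ (x ∷ s₁))) x∷s₁⊆L)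
...   | s₂′ ∷ʳ′ w =
  inj₂ (inj₂ (x , s₁ ++ s₂′ , w , cong (x ∷_) (sym (++-assoc s₁ s₂′ [ w ])) ,
              L>σ (Any-resp-⊆ x∷s₁⊆L (here refl))
                  (Any-resp-⊆ s₂⊆σ (∈-++⁺ʳ s₂′ (here refl)))))

Avoids-++ : ∀ {L σ p} → Above L σ → ¬ EndsBelowStart p → Avoids L p → Avoids σ p → Avoids (L ++ σ) p
Avoids-++ L>σ ¬ends avoidsL avoidsσ (s , s⊆ , oi) with occurrence-split L>σ s⊆
... | inj₁ s⊆L        = avoidsL (s , s⊆L , oi)
... | inj₂ (inj₁ s⊆σ) = avoidsσ (s , s⊆σ , oi)
... | inj₂ (inj₂ ends) = ¬ends (OrderIso-EndsBelowStart ends oi)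

¬increasing-132 : ¬ AllPairs _<_ (1 ∷ 3 ∷ 2 ∷ [])
¬increasing-132 (_ ∷ (s<s (s<s ()) ∷ []) ∷ _)

¬increasing-213 : ¬ AllPairs _<_ (2 ∷ 1 ∷ 3 ∷ [])
¬increasing-213 ((s<s () ∷ _) ∷ _)

¬EndsBelowStart-132 : ¬ EndsBelowStart (1 ∷ 3 ∷ 2 ∷ [])
¬EndsBelowStart-132 ends with EndsBelowStart-∷ʳ {ys = 3 ∷ []} ends
... | s<s ()

¬EndsBelowStart-213 : ¬ EndsBelowStart (2 ∷ 1 ∷ 3 ∷ [])
¬EndsBelowStart-213 ends with EndsBelowStart-∷ʳ {ys = 1 ∷ []} ends
... | s<s (s<s ())

prepend-run-InS : ∀ {m i k σ} → i < k → InS m (R k) σ → InS (m + i) (R k) (run (m + i) i ++ σ)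
prepend-run-InS {m} {i} {k} {σ} i<k (σ↭ , avoids₁ ∷ avoids₂ ∷ avoids₃ ∷ []) =
  π↭ ,
  Avoids-++ L>σ (increasing⇒¬EndsBelowStart (oneTo-increasing k)) L-avoids-12…k avoids₁ ∷
  Avoids-++ L>σ ¬EndsBelowStart-132 (Avoids-increasing L< ¬increasing-132) avoids₂ ∷
  Avoids-++ L>σ ¬EndsBelowStart-213 (Avoids-increasing L< ¬increasing-213) avoids₃ ∷ []
  where
  L = run (m + i) i
  L< : AllPairs _<_ L
  L< = run-increasing (m + i) i
  open PermutationReasoning
  π↭ : L ++ σ ↭ oneTo (m + i)
  π↭ = begin
    L ++ σ        ↭⟨ ++⁺ˡ L σ↭ ⟩
    L ++ oneTo m  ↭⟨ ++-comm L (oneTo m) ⟩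
    oneTo m ++ L  ≡⟨ sym (oneTo-++-run m i) ⟩
    oneTo (m + i) ∎
  L>σ : Above L σ
  L>σ x∈L y∈σ = ≤-<-trans (∈-oneTo⇒≤ (∈-resp-↭ σ↭ y∈σ)) (∈-run⇒> m i x∈L)
  L-avoids-12…k : Avoids L (oneTo k)
  L-avoids-12…k = Avoids-shorter (subst₂ _<_ (sym (length-run (m + i) i)) (sym (length-oneTo k)) i<k)

prepend-into : ∀ {n k i} σ → 1 ≤ i → i < k → Dom n k i σ → Cod n k i (prepend n i σ)
prepend-into σ 1≤i i<k (m , refl , σ∈) =
  prepend-run-InS i<k σ∈ , PosIs-run (m + _) _ σ 1≤i (m≤n+m _ m)

drop-maximum-↭-oneTo : ∀ {a xs ys n} → All (_< a) (xs ++ ys) → xs ++ a ∷ ys ↭ oneTo (suc n) →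
                  a ≡ suc n × xs ++ ys ↭ oneTo n
drop-maximum-↭-oneTo {a} {xs} {ys} {n} below-a π↭ with ≤-antisym a≤n+1 n+1≤a
  where
  a≤n+1 : a ≤ suc n
  a≤n+1 = ∈-oneTo⇒≤ (∈-resp-↭ π↭ (∈-++⁺ʳ xs (here refl)))
  n+1≤a : suc n ≤ a
  n+1≤a with ∈-resp-↭ (shift a xs ys) (∈-resp-↭ (↭-sym π↭) (1+n∈oneTo[1+n] n))
  ... | here n+1≡a   = ≤-reflexive n+1≡a
  ... | there n+1∈   = <⇒≤ (All.lookup below-a n+1∈)
... | refl = refl , subst (xs ++ ys ↭_) (++-identityʳ (oneTo n))
                        (drop-mid xs (oneTo n) (subst (xs ++ suc n ∷ ys ↭_) (oneTo-∷ʳ n) π↭))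

increasing-prefix-above⇒run : ∀ n i {A B} → length A ≡ i → AllPairs _<_ A → Above A B →
                              A ++ B ↭ oneTo n → i ≤ n × A ≡ run n i × B ↭ oneTo (n ∸ i)
increasing-prefix-above⇒run n i {A} len A< A>B π↭ with initLast A
... | [] rewrite sym len = z≤n , refl , π↭
increasing-prefix-above⇒run zero i len A< A>B π↭ | A′ ∷ʳ′ a =
  contradiction (∈-resp-↭ π↭ (∈-++⁺ˡ (∈-++⁺ʳ A′ (here refl)))) λ ()
increasing-prefix-above⇒run (suc n) i len A< A>B π↭ | A′ ∷ʳ′ a with AllPairs-∷ʳ⁻ A′ A<
... | A′< , A′<a
    with drop-maximum-↭-oneTo below-a (subst (_↭ oneTo (suc n)) (++-assoc A′ [ a ] _) π↭)
  where
  below-a : All (_< a) (A′ ++ _)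
  below-a = All-++⁺ A′<a (All.tabulate (A>B (∈-++⁺ʳ A′ (here refl))))
... | refl , π′↭
    with increasing-prefix-above⇒run n (length A′) refl A′< (λ x∈A′ → A>B (∈-++⁺ˡ x∈A′)) π′↭
... | A′≤n , A′≡run , B↭ rewrite sym len | length-∷ʳ A′ (suc n) =
  s≤s A′≤n , trans (cong (_∷ʳ suc n) A′≡run) (sym (run-∷ʳ n (length A′) A′≤n)) , B↭

prefix-through-maximum-increasing-above : ∀ {n pre post} → pre ++ n ∷ post ↭ oneTo n →
  Avoids (pre ++ n ∷ post) (1 ∷ 3 ∷ 2 ∷ []) → Avoids (pre ++ n ∷ post) (2 ∷ 1 ∷ 3 ∷ []) →
  AllPairs _<_ (pre ∷ʳ n) × Above (pre ∷ʳ n) post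
prefix-through-maximum-increasing-above {n} {pre} {post} π↭ avoids-132 avoids-213 =
  AllPairs.++⁺ pre< ([] ∷ []) (All.tabulate (λ x∈pre → pre<n x∈pre ∷ [])) , pre∷n>post
  where
  distinct : ∀ {x y} → x ∷ y ∷ [] ⊆ pre ++ n ∷ post → x ≢ y
  distinct = Unique-pair
    (Permutationₛ.Unique-resp-↭ (setoid ℕ) (↭⇒↭ₛ (↭-sym π↭)) (oneTo-unique n))

  ≤n : ∀ {x} → x ∈ pre ++ n ∷ post → x ≤ n
  ≤n x∈π = ∈-oneTo⇒≤ (∈-resp-↭ π↭ x∈π)

  pre<n : ∀ {x} → x ∈ pre → x < n
  pre<n x∈pre = ≤∧≢⇒< (≤n (∈-++⁺ˡ x∈pre))
                      (distinct (++⁺ (from∈ x∈pre) (refl ∷ minimum post)))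

  post<n : ∀ {y} → y ∈ post → y < n
  post<n y∈post = ≤∧≢⇒< (≤n (∈-++⁺ʳ pre (there y∈post)))
                        (≢-sym (distinct (++⁺ (minimum pre) (refl ∷ from∈ y∈post))))

  pre< : AllPairs _<_ pre
  pre< = AllPairs-fromPairs ordered
    where
    ordered : ∀ {x y} → x ∷ y ∷ [] ⊆ pre → x < y
    ordered {x} {y} xy⊆pre with <-cmp x y
    ... | tri< x<y _ _ = x<y
    ... | tri≈ _ x≡y _ = contradiction x≡y (distinct (++⁺ʳ (n ∷ post) xy⊆pre))
    ... | tri> _ _ y<x = contradiction
      (x ∷ y ∷ n ∷ [] , ++⁺ xy⊆pre (refl ∷ minimum post) ,
       orderIso-213 y<x (pre<n (Any-resp-⊆ xy⊆pre (here refl))))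
      avoids-213

  pre∷n>post : Above (pre ∷ʳ n) post
  pre∷n>post {x} {y} x∈ y∈post with ∈-++⁻ pre x∈
  ... | inj₂ (here refl) = post<n y∈post
  ... | inj₁ x∈pre with <-cmp x y
  ...   | tri< x<y _ _ = contradiction
    (x ∷ n ∷ y ∷ [] , ++⁺ (from∈ x∈pre) (refl ∷ from∈ y∈post) , orderIso-132 x<y (post<n y∈post))
    avoids-132
  ...   | tri≈ _ x≡y _ =
    contradiction x≡y (distinct (++⁺ (from∈ x∈pre) (n Sublist.∷ʳ from∈ y∈post)))
  ...   | tri> _ _ y<x = y<x

prepend-onto : ∀ n k i π → Cod n k i π → ∃[ σ ] (Dom n k i σ × prepend n i σ ≡ π)
prepend-onto n k i π ((π↭ , avoids@(_ ∷ avoids-132 ∷ avoids-213 ∷ [])) , n-at-i)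
    with PosIs⇒++ {π} n-at-i
... | pre , post , refl , len
    with prefix-through-maximum-increasing-above π↭ avoids-132 avoids-213
... | pre∷n< , pre∷n>post
    with increasing-prefix-above⇒run n i (trans (length-++ pre) len) pre∷n< pre∷n>post
           (subst (_↭ oneTo n) (sym (++-assoc pre [ n ] post)) π↭)
... | i≤n , pre∷n≡run , post↭ =
  post ,
  (n ∸ i , m∸n+n≡m i≤n , post↭ , All.map (Avoids-⊆ post⊆π) avoids) ,
  trans (cong (_++ post) (sym pre∷n≡run)) (++-assoc pre [ n ] post)
  where
  post⊆π : post ⊆ pre ++ n ∷ post
  post⊆π = ++⁺ (minimum pre) (n Sublist.∷ʳ ⊆-refl)

lemma3p4 : (n k i : ℕ) → 1 ≤ n → 2 ≤ k → 1 ≤ i → i ≤ k ∸ 1 →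
    ((σ : List ℕ) → Dom n k i σ → Cod n k i (prepend n i σ))
    × ((σ τ : List ℕ) → Dom n k i σ → Dom n k i τ → prepend n i σ ≡ prepend n i τ → σ ≡ τ)
    × ((π : List ℕ) → Cod n k i π → ∃[ σ ] (Dom n k i σ × prepend n i σ ≡ π))
lemma3p4 n k i _ (s≤s (s≤s _)) 1≤i i≤k∸1 =
  (λ σ → prepend-into σ 1≤i (s≤s i≤k∸1)) ,
  (λ σ τ _ _ → ++-cancelˡ (run n i) σ τ) ,
  prepend-onto n k i
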